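{- For a positive integer $m$ let $\tau(m)$ denote the number of positive divisors of $m$, and for positive integers $n$ define $f(n):=\sum_{1\le k\le n} \tau(2^k-1)$. Call a positive integer $N$ an index of a highly-composite Mersenne number if $\tau(2^N-1)>\tau(2^m-1)$ for all integers $1\le m<N$. Assume that, as $N$ tends to infinity through the indices of highly-composite Mersenne numbers, $\tau(2^N+1)/N\to\infty$. Then $$\lim_{n\to\infty}\frac{f(2n)}{f(n)}=\infty.$$
   Context: $\tau(m)$ is the number of positive divisors of $m$. The set of indices of highly-composite Mersenne numbers (as defined in the claim) is infinite, so the limit along this set in the hypothesis makes sense. -}

module Defs where

open import Data.Nat using (ℕ; suc; _+_; _*_; _∸_; _^_; _≤_; _<_)
open import Data.Nat.Divisibility using (_∣?_)
open import Data.List using (length; filter; map; upTo)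
open import Data.Nat.ListAction using (sum)

τ : ℕ → ℕ
τ m = length (filter (_∣? m) (map suc (upTo m)))

f : ℕ → ℕ
f n = sum (map (λ k → τ (2 ^ suc k ∸ 1)) (upTo n))

HCIndex : ℕ → Set
HCIndex N = (1 ≤ N) × ((m : ℕ) → 1 ≤ m → m < N → τ (2 ^ m ∸ 1) < τ (2 ^ N ∸ 1))
  where open import Data.Product using (_×_)

-- Write τᴹ k = τ(2ᵏ - 1) and let N be the first maximiser of τᴹ on 1, …, n; it is an index
-- of a highly-composite Mersenne number, and N → ∞ with n because τᴹ (2ᵏ) ≥ 2ᵏ. The factors
-- of 2^(2N) - 1 = (2ᴺ - 1)(2ᴺ + 1) are coprime, so τᴹ (2N) ≥ τᴹ N · τ(2ᴺ + 1), which by the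
-- hypothesis is ≥ 2MN · τᴹ N for any given M once n is large. Since 2ᵃ - 1 ∣ 2^(ja) - 1,
-- each of the q = ⌊n/N⌋ multiples of 2N up to 2qN ≤ 2n contributes at least τᴹ (2N) to
-- f(2n), whereas f(n) ≤ n · τᴹ N ≤ 2qN · τᴹ N.

module Submission where

open import Defs
open import Data.Nat using (ℕ; _+_; _*_; _^_; _≤_)
open import Data.Product using (Σ)

open import Level using (Level)
open import Data.Nat using (zero; suc; _∸_; _<_; _>_; _≤′_; ≤′-refl; ≤′-step; z≤n; s≤s; NonZero; >-nonZero; >-nonZero⁻¹; _/_; _%_)
open import Data.Nat.Properties
open import Data.Nat.DivMod using (m/n*n≤m; m≥n⇒m/n>0; m≡m%n+[m/n]*n; m%n<n)
open import Data.Nat.Divisibility using (_∣_; _∣?_; divides; ∣-trans; ∣-antisym; *-pres-∣; ∣⇒≤; 0∣⇒≡0; ∣1⇒≡1; ∣m+n∣m⇒∣n; m∣m*n; n∣m*n; ∣-refl)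
open import Data.Nat.Coprimality using (Coprime; coprime-divisor) renaming (sym to ⊥-sym)
open import Data.Nat.Primality using (irreducible[2])
open import Data.Nat.ListAction using (sum)
open import Data.Nat.ListAction.Properties using (sum-++)
open import Data.Nat.Tactic.RingSolver using (solve-∀)
open import Data.Fin using (Fin; zero; suc)
open import Data.Fin.Properties using (injective⇒≤)
open import Data.List using (List; []; _∷_; [_]; _++_; length; lookup; filter; map; upTo; cartesianProductWith; cartesianProduct)
open import Data.List.Properties using (length-++; length-map; length-filter; length-upTo; upTo-∷ʳ; map-++)
open import Data.List.Membership.Propositional using (_∈_)
open import Data.List.Membership.Propositional.Properties using (∈-lookup; ∈-map⁺; ∈-upTo⁺; ∈-filter⁺; ∈-filter⁻; ∈-cartesianProduct⁻)
open import Data.List.Relation.Unary.All as All using ([]; _∷_)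
open import Data.List.Relation.Unary.AllPairs using ([]; _∷_)
open import Data.List.Relation.Unary.Any using (here; there; index)
open import Data.List.Relation.Unary.Any.Properties using (lookup-index)
open import Data.List.Relation.Unary.Unique.Propositional using (Unique)
import Data.List.Relation.Unary.Unique.Propositional.Properties as Unique
open import Data.Product using (_×_; _,_; proj₁; proj₂; ∃-syntax; uncurry)
open import Data.Sum using (inj₁; inj₂)
open import Function using (_∘_)
open import Relation.Nullary using (¬_; yes; no; contradiction)
open import Relation.Binary.PropositionalEquality using (_≡_; refl; sym; trans; cong; cong₂; subst; module ≡-Reasoning)

private variable
  a b ℓ : Level
  A B : Set a

lookup-injective : ∀ {xs : List A} → Unique xs → ∀ {i j} → lookup xs i ≡ lookup xs j → i ≡ j
lookup-injective (_ ∷ _) {zero} {zero} _ = refl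
lookup-injective (x∉xs ∷ _) {zero} {suc j} eq = contradiction eq (All.lookup x∉xs (∈-lookup j))
lookup-injective (x∉xs ∷ _) {suc i} {zero} eq = contradiction (sym eq) (All.lookup x∉xs (∈-lookup i))
lookup-injective (_ ∷ u) {suc i} {suc j} eq = cong suc (lookup-injective u eq)

length-≤-by-injection : ∀ {xs : List A} {ys : List B} (g : A → B) → Unique xs →
                        (∀ {x} → x ∈ xs → g x ∈ ys) →
                        (∀ {x y} → x ∈ xs → y ∈ xs → g x ≡ g y → x ≡ y) →
                        length xs ≤ length ys
length-≤-by-injection {xs = xs} {ys} g xs! g∈ys g-inj = injective⇒≤ position-injective
  where
  position : Fin (length xs) → Fin (length ys)
  position i = index (g∈ys (∈-lookup i))
  position-injective : ∀ {i j} → position i ≡ position j → i ≡ j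
  position-injective {i} {j} eq = lookup-injective xs! (g-inj (∈-lookup i) (∈-lookup j) (begin
    g (lookup xs i)          ≡⟨ lookup-index (g∈ys (∈-lookup i)) ⟩
    lookup ys (position i)   ≡⟨ cong (lookup ys) eq ⟩
    lookup ys (position j)   ≡⟨ lookup-index (g∈ys (∈-lookup j)) ⟨
    g (lookup xs j)          ∎))
    where open ≡-Reasoning

length-cartesianProductWith : ∀ {C : Set ℓ} (f : A → B → C) xs ys →
                              length (cartesianProductWith f xs ys) ≡ length xs * length ys
length-cartesianProductWith f []       ys = refl
length-cartesianProductWith f (x ∷ xs) ys = trans (length-++ (map (f x) ys))
  (cong₂ _+_ (length-map (f x) ys) (length-cartesianProductWith f xs ys))

divisors : ℕ → List ℕ
divisors n = filter (_∣? n) (map suc (upTo n))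

divisors-unique : ∀ n → Unique (divisors n)
divisors-unique n = Unique.filter⁺ (_∣? n) (Unique.map⁺ suc-injective (Unique.upTo⁺ n))

∈-divisors⁻ : ∀ {d n} → d ∈ divisors n → d ∣ n
∈-divisors⁻ {n = n} d∈ = proj₂ (∈-filter⁻ (_∣? n) {xs = map suc (upTo n)} d∈)

∈-divisors⁺ : ∀ {d n} .{{_ : NonZero n}} → d ∣ n → d ∈ divisors n
∈-divisors⁺ {zero}  {suc _} 0∣n with () ← 0∣⇒≡0 0∣n
∈-divisors⁺ {suc d} {n}     d∣n = ∈-filter⁺ (_∣? n) (∈-map⁺ suc (∈-upTo⁺ (∣⇒≤ d∣n))) d∣n

τ-≤ : ∀ n → τ n ≤ n
τ-≤ n = begin
  τ n                         ≤⟨ length-filter (_∣? n) (map suc (upTo n)) ⟩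
  length (map suc (upTo n))   ≡⟨ length-map suc (upTo n) ⟩
  length (upTo n)             ≡⟨ length-upTo n ⟩
  n                           ∎
  where open ≤-Reasoning

τ-mono-∣ : ∀ {m n} .{{_ : NonZero n}} → m ∣ n → τ m ≤ τ n
τ-mono-∣ {m} m∣n = length-≤-by-injection (λ d → d) (divisors-unique m)
  (λ d∈ → ∈-divisors⁺ (∣-trans (∈-divisors⁻ d∈) m∣n)) (λ _ _ eq → eq)

2≤τ : ∀ {n} → 2 ≤ n → 2 ≤ τ n
2≤τ {n} 2≤n = length-≤-by-injection (λ d → d) ((<⇒≢ 2≤n ∷ []) ∷ [] ∷ []) one-and-n∈
  (λ _ _ eq → eq)
  where
  instance _ = >-nonZero (≤-trans (s≤s z≤n) 2≤n)
  one-and-n∈ : ∀ {d} → d ∈ 1 ∷ n ∷ [] → d ∈ divisors n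
  one-and-n∈ (here refl)         = ∈-divisors⁺ (divides n (sym (*-identityʳ n)))
  one-and-n∈ (there (here refl)) = ∈-divisors⁺ ∣-refl

coprime-factor-∣ : ∀ {x y x′ y′} → Coprime x y′ → x * y ≡ x′ * y′ → x ∣ x′
coprime-factor-∣ {x} {y} {x′} {y′} x⊥y′ eq =
  coprime-divisor x⊥y′ (subst (x ∣_) (trans eq (*-comm x′ y′)) (m∣m*n y))

τ-*-coprime : ∀ {m n} .{{_ : NonZero m}} .{{_ : NonZero n}} → Coprime m n →
              τ m * τ n ≤ τ (m * n)
τ-*-coprime {m} {n} m⊥n = subst (_≤ τ (m * n))
  (length-cartesianProductWith _,_ (divisors m) (divisors n))
  (length-≤-by-injection (uncurry _*_)
    (Unique.cartesianProduct⁺ (divisors-unique m) (divisors-unique n))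
    product∈ product-injective)
  where
  instance _ = m*n≢0 m n
  product∈ : ∀ {p} → p ∈ cartesianProduct (divisors m) (divisors n) → uncurry _*_ p ∈ divisors (m * n)
  product∈ p∈ with d∈ , e∈ ← ∈-cartesianProduct⁻ (divisors m) (divisors n) p∈ =
    ∈-divisors⁺ (*-pres-∣ (∈-divisors⁻ {n = m} d∈) (∈-divisors⁻ {n = n} e∈))
  divisors-coprime : ∀ {x y} → x ∈ divisors m → y ∈ divisors n → Coprime x y
  divisors-coprime x∈ y∈ (c∣x , c∣y) =
    m⊥n (∣-trans c∣x (∈-divisors⁻ {n = m} x∈) , ∣-trans c∣y (∈-divisors⁻ {n = n} y∈))
  product-injective : ∀ {p q} → p ∈ cartesianProduct (divisors m) (divisors n) →
                      q ∈ cartesianProduct (divisors m) (divisors n) →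
                      uncurry _*_ p ≡ uncurry _*_ q → p ≡ q
  product-injective {x , y} {x′ , y′} p∈ q∈ eq
    with x∈ , y∈ ← ∈-cartesianProduct⁻ (divisors m) (divisors n) p∈
       | x′∈ , y′∈ ← ∈-cartesianProduct⁻ (divisors m) (divisors n) q∈ =
    cong₂ _,_
      (∣-antisym (coprime-factor-∣ (divisors-coprime x∈ y′∈) eq)
                 (coprime-factor-∣ (divisors-coprime x′∈ y∈) (sym eq)))
      (∣-antisym (coprime-factor-∣ (⊥-sym (divisors-coprime x′∈ y∈)) swapped)
                 (coprime-factor-∣ (⊥-sym (divisors-coprime x∈ y′∈)) (sym swapped)))
    where
    swapped : y * x ≡ y′ * x′
    swapped = trans (*-comm y x) (trans eq (*-comm x′ y′))

τᴹ : ℕ → ℕ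
τᴹ n = τ (2 ^ n ∸ 1)

[1+m]^n≡1+q*m : ∀ m n → ∃[ q ] suc m ^ n ≡ suc (q * m)
[1+m]^n≡1+q*m m zero    = 0 , refl
[1+m]^n≡1+q*m m (suc n) with q , eq ← [1+m]^n≡1+q*m m n =
  q + suc (q * m) , trans (cong (suc m *_) eq) (expand m q)
  where
  expand : ∀ m q → suc m * suc (q * m) ≡ suc ((q + suc (q * m)) * m)
  expand = solve-∀

m∣[1+m]^n∸1 : ∀ m n → m ∣ suc m ^ n ∸ 1
m∣[1+m]^n∸1 m n with q , eq ← [1+m]^n≡1+q*m m n = divides q (cong (_∸ 1) eq)

1+[2^n∸1]≡2^n : ∀ n → suc (2 ^ n ∸ 1) ≡ 2 ^ n
1+[2^n∸1]≡2^n n = trans (+-comm 1 (2 ^ n ∸ 1)) (m∸n+n≡m (m^n>0 2 n))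

2^n∸1>0 : ∀ n .{{_ : NonZero n}} → 2 ^ n ∸ 1 > 0
2^n∸1>0 (suc n) = ∸-monoˡ-≤ 1 (*-monoʳ-≤ 2 (m^n>0 2 n))

2^m∸1∣2^[m*n]∸1 : ∀ m n → 2 ^ m ∸ 1 ∣ 2 ^ (m * n) ∸ 1
2^m∸1∣2^[m*n]∸1 m n = subst (λ k → 2 ^ m ∸ 1 ∣ k ∸ 1)
  (trans (cong (_^ n) (1+[2^n∸1]≡2^n m)) (^-*-assoc 2 m n))
  (m∣[1+m]^n∸1 (2 ^ m ∸ 1) n)

τᴹ-mono-∣ : ∀ {m n} .{{_ : NonZero n}} → m ∣ n → τᴹ m ≤ τᴹ n
τᴹ-mono-∣ {m} {n} (divides q refl) = τ-mono-∣ {{>-nonZero (2^n∸1>0 n)}}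
  (subst (λ k → 2 ^ m ∸ 1 ∣ 2 ^ k ∸ 1) (*-comm m q) (2^m∸1∣2^[m*n]∸1 m q))

2∤2^n∸1 : ∀ n .{{_ : NonZero n}} → ¬ 2 ∣ 2 ^ n ∸ 1
2∤2^n∸1 (suc n) 2∣2^n∸1 = contradiction (∣1⇒≡1 (∣m+n∣m⇒∣n 2∣2^n∸1+1 2∣2^n∸1)) λ ()
  where
  2∣2^n∸1+1 : 2 ∣ (2 ^ suc n ∸ 1) + 1
  2∣2^n∸1+1 = subst (2 ∣_) (sym (m∸n+n≡m (m^n>0 2 (suc n)))) (m∣m*n (2 ^ n))

odd⇒coprime-+2 : ∀ {m} → ¬ 2 ∣ m → Coprime m (m + 2)
odd⇒coprime-+2 2∤m (d∣m , d∣m+2) with irreducible[2] (∣m+n∣m⇒∣n d∣m+2 d∣m)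
... | inj₁ d≡1 = d≡1
... | inj₂ refl = contradiction d∣m 2∤m

2^n+1≡[2^n∸1]+2 : ∀ n → 2 ^ n + 1 ≡ (2 ^ n ∸ 1) + 2
2^n+1≡[2^n∸1]+2 n = trans (cong (_+ 1) (sym (1+[2^n∸1]≡2^n n))) (sym (+-suc (2 ^ n ∸ 1) 1))

2^[2n]∸1≡[2^n∸1]*[2^n+1] : ∀ n → 2 ^ (2 * n) ∸ 1 ≡ (2 ^ n ∸ 1) * (2 ^ n + 1)
2^[2n]∸1≡[2^n∸1]*[2^n+1] n = begin
  2 ^ (2 * n) ∸ 1         ≡⟨ cong (λ k → 2 ^ (n + k) ∸ 1) (+-identityʳ n) ⟩
  2 ^ (n + n) ∸ 1         ≡⟨ cong (_∸ 1) (^-distribˡ-+-* 2 n n) ⟩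
  2 ^ n * 2 ^ n ∸ 1       ≡⟨ cong (λ k → k * k ∸ 1) (1+[2^n∸1]≡2^n n) ⟨
  suc c * suc c ∸ 1       ≡⟨ cong (_∸ 1) (factor c) ⟩
  c * (suc c + 1)         ≡⟨ cong (λ k → c * (k + 1)) (1+[2^n∸1]≡2^n n) ⟩
  c * (2 ^ n + 1)         ∎
  where
  open ≡-Reasoning
  c = 2 ^ n ∸ 1
  factor : ∀ c → suc c * suc c ≡ suc (c * (suc c + 1))
  factor = solve-∀

τᴹ[n]*τ[2^n+1]≤τᴹ[2n] : ∀ n .{{_ : NonZero n}} → τᴹ n * τ (2 ^ n + 1) ≤ τᴹ (2 * n)
τᴹ[n]*τ[2^n+1]≤τᴹ[2n] n = subst (τᴹ n * τ (2 ^ n + 1) ≤_)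
  (cong τ (sym (2^[2n]∸1≡[2^n∸1]*[2^n+1] n)))
  (τ-*-coprime (subst (Coprime (2 ^ n ∸ 1)) (sym (2^n+1≡[2^n∸1]+2 n))
                 (odd⇒coprime-+2 (2∤2^n∸1 n))))
  where
  instance
    _ = >-nonZero (2^n∸1>0 n)
    _ = >-nonZero (m≤n+m 1 (2 ^ n))

2^k≤τᴹ[2^k] : ∀ k → 2 ^ k ≤ τᴹ (2 ^ k)
2^k≤τᴹ[2^k] zero    = ≤-refl
2^k≤τᴹ[2^k] (suc k) = begin
  2 * 2 ^ k                           ≡⟨ *-comm 2 (2 ^ k) ⟩
  2 ^ k * 2                           ≤⟨ *-mono-≤ (2^k≤τᴹ[2^k] k) (2≤τ (+-monoˡ-≤ 1 (m^n>0 2 (2 ^ k)))) ⟩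
  τᴹ (2 ^ k) * τ (2 ^ (2 ^ k) + 1)    ≤⟨ τᴹ[n]*τ[2^n+1]≤τᴹ[2n] (2 ^ k) ⟩
  τᴹ (2 * 2 ^ k)                      ∎
  where
  open ≤-Reasoning
  instance _ = m^n≢0 2 k

f-suc : ∀ n → f (suc n) ≡ f n + τᴹ (suc n)
f-suc n = begin
  f (suc n)                          ≡⟨ cong (sum ∘ map g) (upTo-∷ʳ n) ⟨
  sum (map g (upTo n ++ [ n ]))      ≡⟨ cong sum (map-++ g (upTo n) [ n ]) ⟩
  sum (map g (upTo n) ++ [ g n ])    ≡⟨ sum-++ (map g (upTo n)) [ g n ] ⟩
  f n + (g n + 0)                    ≡⟨ cong (f n +_) (+-identityʳ (g n)) ⟩
  f n + τᴹ (suc n)                   ∎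
  where
  open ≡-Reasoning
  g : ℕ → ℕ
  g k = τᴹ (suc k)

f-mono : ∀ {m n} → m ≤ n → f m ≤ f n
f-mono m≤n = go (≤⇒≤′ m≤n)
  where
  go : ∀ {m n} → m ≤′ n → f m ≤ f n
  go ≤′-refl         = ≤-refl
  go (≤′-step {n} p) = ≤-trans (go p) (≤-trans (m≤m+n (f n) _) (≤-reflexive (sym (f-suc n))))

f-step : ∀ {m n} → m < n → f m + τᴹ n ≤ f n
f-step {m} {suc n} (s≤s m≤n) = begin
  f m + τᴹ (suc n)    ≤⟨ +-monoˡ-≤ (τᴹ (suc n)) (f-mono m≤n) ⟩
  f n + τᴹ (suc n)    ≡⟨ f-suc n ⟨
  f (suc n)           ∎
  where open ≤-Reasoning

q*τᴹ[n]≤f[q*n] : ∀ q n .{{_ : NonZero n}} → q * τᴹ n ≤ f (q * n)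
q*τᴹ[n]≤f[q*n] zero    n = z≤n
q*τᴹ[n]≤f[q*n] (suc q) n = begin
  τᴹ n + q * τᴹ n                ≤⟨ +-mono-≤ (τᴹ-mono-∣ {n} {suc q * n} (n∣m*n (suc q))) (q*τᴹ[n]≤f[q*n] q n) ⟩
  τᴹ (n + q * n) + f (q * n)     ≡⟨ +-comm (τᴹ (n + q * n)) (f (q * n)) ⟩
  f (q * n) + τᴹ (n + q * n)     ≤⟨ f-step (m<n+m (q * n) (>-nonZero⁻¹ n)) ⟩
  f (n + q * n)                  ∎
  where
  open ≤-Reasoning
  instance _ = m*n≢0 (suc q) n

BoundedOn : (ℕ → ℕ) → ℕ → ℕ → Set
BoundedOn g n B = ∀ k → 1 ≤ k → k ≤ n → g k ≤ B

f≤n*B : ∀ n {B} → BoundedOn τᴹ n B → f n ≤ n * B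
f≤n*B zero    _       = z≤n
f≤n*B (suc n) {B} bnd = begin
  f (suc n)           ≡⟨ f-suc n ⟩
  f n + τᴹ (suc n)    ≤⟨ +-mono-≤ (f≤n*B n (λ k 1≤k k≤n → bnd k 1≤k (m≤n⇒m≤1+n k≤n)))
                                  (bnd (suc n) (s≤s z≤n) ≤-refl) ⟩
  n * B + B           ≡⟨ +-comm (n * B) B ⟩
  suc n * B           ∎
  where open ≤-Reasoning

-- HCIndex N is definitionally RecordIndex τᴹ N.
RecordIndex : (ℕ → ℕ) → ℕ → Set
RecordIndex g N = 1 ≤ N × (∀ m → 1 ≤ m → m < N → g m < g N)

first-maximum-is-record : ∀ g n → 1 ≤ n → ∃[ N ] RecordIndex g N × N ≤ n × BoundedOn g n (g N)
first-maximum-is-record g (suc zero) _ = 1 , (≤-refl , λ { m (s≤s z≤n) (s≤s ()) }) , ≤-refl ,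
  λ { .1 (s≤s z≤n) (s≤s z≤n) → ≤-refl }
first-maximum-is-record g (suc (suc n)) _
  with N , (1≤N , N-record) , N≤n , N-max ← first-maximum-is-record g (suc n) (s≤s z≤n)
     | g N <? g (suc (suc n))
... | yes gN<g[n+2] = suc (suc n) , (s≤s z≤n , new-record) , ≤-refl , new-max
  where
  new-record : ∀ m → 1 ≤ m → m < suc (suc n) → g m < g (suc (suc n))
  new-record m 1≤m (s≤s m≤n) = ≤-<-trans (N-max m 1≤m m≤n) gN<g[n+2]
  new-max : BoundedOn g (suc (suc n)) (g (suc (suc n)))
  new-max k 1≤k k≤n+2 with m≤n⇒m<n∨m≡n k≤n+2
  ... | inj₁ (s≤s k≤n) = ≤-trans (N-max k 1≤k k≤n) (<⇒≤ gN<g[n+2])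
  ... | inj₂ refl      = ≤-refl
... | no gN≮g[n+2] = N , (1≤N , N-record) , m≤n⇒m≤1+n N≤n , old-max
  where
  old-max : BoundedOn g (suc (suc n)) (g N)
  old-max k 1≤k k≤n+2 with m≤n⇒m<n∨m≡n k≤n+2
  ... | inj₁ (s≤s k≤n) = N-max k 1≤k k≤n
  ... | inj₂ refl      = ≮⇒≥ gN≮g[n+2]

exponent-< : ∀ {k N} → 2 ^ k ≤ τᴹ N → k < N
exponent-< {k} {N} 2^k≤τᴹN = ≰⇒> λ N≤k → <⇒≱ (begin-strict
  2 ^ k        ≤⟨ 2^k≤τᴹN ⟩
  τᴹ N         ≤⟨ τ-≤ (2 ^ N ∸ 1) ⟩
  2 ^ N ∸ 1    <⟨ ≤-reflexive (1+[2^n∸1]≡2^n N) ⟩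
  2 ^ N        ∎) (^-monoʳ-≤ 2 N≤k)
  where open ≤-Reasoning

m≤2*[m/n*n] : ∀ {m n} .{{_ : NonZero n}} → n ≤ m → m ≤ 2 * (m / n * n)
m≤2*[m/n*n] {m} {n} n≤m = begin
  m                              ≡⟨ m≡m%n+[m/n]*n m n ⟩
  m % n + m / n * n              ≤⟨ +-monoˡ-≤ (m / n * n) (≤-trans (<⇒≤ (m%n<n m n)) n≤m/n*n) ⟩
  m / n * n + m / n * n          ≡⟨ cong (m / n * n +_) (+-identityʳ (m / n * n)) ⟨
  2 * (m / n * n)                ∎
  where
  open ≤-Reasoning
  n≤m/n*n : n ≤ m / n * n
  n≤m/n*n = ≤-trans (≤-reflexive (sym (*-identityˡ n))) (*-monoˡ-≤ n (m≥n⇒m/n>0 n≤m))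

f-ratio-at-maximum : ∀ M {n N} .{{_ : NonZero N}} → N ≤ n → BoundedOn τᴹ n (τᴹ N) →
                     2 * M * N ≤ τ (2 ^ N + 1) → M * f n ≤ f (2 * n)
f-ratio-at-maximum M {n} {N} N≤n N-max 2MN≤τ = begin
  M * f n                          ≤⟨ *-monoʳ-≤ M (f≤n*B n N-max) ⟩
  M * (n * τᴹ N)                   ≤⟨ *-monoʳ-≤ M (*-monoˡ-≤ (τᴹ N) (m≤2*[m/n*n] N≤n)) ⟩
  M * (2 * (q * N) * τᴹ N)         ≡⟨ regroup M q N (τᴹ N) ⟩
  q * (τᴹ N * (2 * M * N))         ≤⟨ *-monoʳ-≤ q (*-monoʳ-≤ (τᴹ N) 2MN≤τ) ⟩
  q * (τᴹ N * τ (2 ^ N + 1))       ≤⟨ *-monoʳ-≤ q (τᴹ[n]*τ[2^n+1]≤τᴹ[2n] N) ⟩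
  q * τᴹ (2 * N)                   ≤⟨ q*τᴹ[n]≤f[q*n] q (2 * N) ⟩
  f (q * (2 * N))                  ≤⟨ f-mono q*2N≤2n ⟩
  f (2 * n)                        ∎
  where
  open ≤-Reasoning
  instance _ = m*n≢0 2 N
  q = n / N
  regroup : ∀ M q N t → M * (2 * (q * N) * t) ≡ q * (t * (2 * M * N))
  regroup = solve-∀
  q*2N≤2n : q * (2 * N) ≤ 2 * n
  q*2N≤2n = subst (_≤ 2 * n) (*-left-comm 2 q N) (*-monoʳ-≤ 2 (m/n*n≤m n N))
    where
    *-left-comm : ∀ a b c → a * (b * c) ≡ b * (a * c)
    *-left-comm = solve-∀

theorem2 : ((M : ℕ) → Σ ℕ (λ N₀ → (N : ℕ) → HCIndex N → N₀ ≤ N → M * N ≤ τ (2 ^ N + 1)))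
    → (M : ℕ) → Σ ℕ (λ n₀ → (n : ℕ) → n₀ ≤ n → M * f n ≤ f (2 * n))
theorem2 hypothesis M with N₀ , τ[2^N+1]-large ← hypothesis (2 * M) = 2 ^ N₀ , ratio-≥-M
  where
  ratio-≥-M : ∀ n → 2 ^ N₀ ≤ n → M * f n ≤ f (2 * n)
  ratio-≥-M n 2^N₀≤n
    with N , N-record , N≤n , N-max ← first-maximum-is-record τᴹ n (≤-trans (m^n>0 2 N₀) 2^N₀≤n) =
    f-ratio-at-maximum M {{>-nonZero (proj₁ N-record)}} N≤n N-max (τ[2^N+1]-large N N-record N₀≤N)
    where
    N₀≤N : N₀ ≤ N
    N₀≤N = <⇒≤ (exponent-< (≤-trans (2^k≤τᴹ[2^k] N₀) (N-max (2 ^ N₀) (m^n>0 2 N₀) 2^N₀≤n)))
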